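{- Let $\Gamma$ be a finite $G$-arc-transitive digraph of valency $r\geq 2$, where $G\leq\mathrm{Aut}(\Gamma)$. Then $|\Gamma^+(u)\cap\Gamma^+(v)|\neq r-1$ for every arc $(u,v)$ of $\Gamma$.
   Context: A digraph $\Gamma$ consists of a finite vertex set $V(\Gamma)$ with an antisymmetric irreflexive relation $\rightarrow$; an arc is an ordered pair $(u,v)$ with $u\rightarrow v$; $\Gamma^+(v)=\{w: v\rightarrow w\}$ and the valency is $|\Gamma^+(v)|$. $G$-arc-transitive means $G$ is transitive on the set of arcs. -}

module Defs where

open import Data.Nat using (ℕ)
open import Data.Fin using (Fin)
open import Data.Bool using (Bool; true; false; _∧_)
open import Data.List using (List; length; filter)
open import Data.List using (allFin)
open import Data.Product using (_×_; Σ; ∃; _,_)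
open import Relation.Binary.PropositionalEquality using (_≡_)
open import Data.Bool.Properties using () renaming (_≟_ to _≟ᵇ_)
open import Data.Fin.Permutation using (Permutation′; _⟨$⟩ʳ_; id; flip; _∘ₚ_)

record Digraph (n : ℕ) : Set where
  field
    adj     : Fin n → Fin n → Bool
    irrefl  : ∀ u → adj u u ≡ false
    antisym : ∀ u v → adj u v ≡ true → adj v u ≡ false

open Digraph public

Arc : ∀ {n} → Digraph n → Fin n → Fin n → Set
Arc Γ u v = adj Γ u v ≡ true

outDeg : ∀ {n} → Digraph n → Fin n → ℕ
outDeg Γ u = length (filter (λ w → adj Γ u w ≟ᵇ true) (allFin _))

commonOut : ∀ {n} → Digraph n → Fin n → Fin n → ℕ
commonOut Γ u v = length (filter (λ w → (adj Γ u w ∧ adj Γ v w) ≟ᵇ true) (allFin _))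

HasValency : ∀ {n} → Digraph n → ℕ → Set
HasValency Γ r = ∀ u → outDeg Γ u ≡ r

IsAut : ∀ {n} → Digraph n → Permutation′ n → Set
IsAut Γ g = ∀ u v → adj Γ (g ⟨$⟩ʳ u) (g ⟨$⟩ʳ v) ≡ adj Γ u v

record Subgroup {n} (Γ : Digraph n) : Set₁ where
  field
    Mem     : Permutation′ n → Set
    ext     : ∀ g h → (∀ x → g ⟨$⟩ʳ x ≡ h ⟨$⟩ʳ x) → Mem g → Mem h
    isAut   : ∀ g → Mem g → IsAut Γ g
    hasId   : Mem id
    closed∘ : ∀ g h → Mem g → Mem h → Mem (g ∘ₚ h)
    closedInv : ∀ g → Mem g → Mem (flip g)

open Subgroup public

ArcTransitive : ∀ {n} {Γ : Digraph n} → Subgroup Γ → Set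
ArcTransitive {n} {Γ} G =
  ∀ u v x y → Arc Γ u v → Arc Γ x y →
    Σ (Permutation′ n) λ g → Mem G g × (g ⟨$⟩ʳ u ≡ x) × (g ⟨$⟩ʳ v ≡ y)

-- Let C = Γ⁺(u) ∩ Γ⁺(v). If |C| = r − 1 ≥ 1, pick c ∈ C and an element g of G
-- mapping the arc (u, v) to the arc (u, c). Then g(C) ⊆ Γ⁺(u) ∩ Γ⁺(c), so
-- Γ⁺(u) contains v, c and the r − 1 vertices of g(C). These are pairwise
-- distinct: c ∉ g(C) since c ↛ c, and v ∉ g(C) since v → c forbids c → v.
-- Hence |Γ⁺(u)| ≥ r + 1, a contradiction.
module Submission where

open import Defs
open import Data.Nat using (ℕ; _≤_; _∸_; suc; z≤n; s≤s)
open import Data.Nat.Properties using (<-≤-trans; n≮n)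
open import Data.Bool using (true; _∧_)
open import Data.Bool.Properties using () renaming (_≟_ to _≟ᵇ_)
open import Data.Fin using (Fin; _≟_)
open import Data.List using (List; []; _∷_; length; filter; map; allFin)
open import Data.List.Properties using (filter-notAll; length-map)
open import Data.List.Membership.Propositional using (_∈_)
open import Data.List.Membership.Propositional.Properties
  using (∈-filter⁺; ∈-filter⁻; ∈-map⁻; ∈-allFin)
open import Data.List.Relation.Unary.Any using (here; there)
import Data.List.Relation.Unary.Any as Any
import Data.List.Relation.Unary.All as All
open import Data.List.Relation.Unary.AllPairs using (_∷_)
open import Data.List.Relation.Unary.Unique.Propositional using (Unique)
open import Data.List.Relation.Unary.Unique.Propositional.Properties
  using (map⁺; filter⁺; allFin⁺; Unique[x∷xs]⇒x∉xs)
open import Data.Fin.Permutation using (Permutation′; _⟨$⟩ʳ_; _⟨$⟩ˡ_; inverseˡ)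
open import Data.Product using (_×_; _,_; ∃; proj₁; proj₂)
open import Relation.Nullary using (¬_; ¬?)
open import Relation.Binary.Definitions using (DecidableEquality)
open import Relation.Binary.PropositionalEquality
  using (_≡_; _≢_; refl; sym; trans; cong; subst; subst₂; module ≡-Reasoning)

length-≤-Unique-⊆ : ∀ {A : Set} → DecidableEquality A → ∀ {xs ys : List A} →
  Unique xs → (∀ {x} → x ∈ xs → x ∈ ys) → length xs ≤ length ys
length-≤-Unique-⊆ _≟_ {xs = []}     _          _    = z≤n
length-≤-Unique-⊆ _≟_ {xs = x ∷ xs} {ys} (x∉ ∷ u) xs⊆ys =
  <-≤-trans (s≤s (length-≤-Unique-⊆ _≟_ u xs⊆ys-x))
            (filter-notAll ≢x? ys (Any.map (λ y≡x x≢y → x≢y (sym y≡x)) (xs⊆ys (here refl))))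
  where
  ≢x? = λ y → ¬? (y ≟ x)
  xs⊆ys-x : ∀ {y} → y ∈ xs → y ∈ filter ≢x? ys
  xs⊆ys-x {y} y∈xs = ∈-filter⁺ ≢x? (xs⊆ys (there y∈xs))
    (λ y≡x → Unique[x∷xs]⇒x∉xs (x∉ ∷ u) (subst (_∈ xs) y≡x y∈xs))

∧≡true⁻ : ∀ {a b} → (a ∧ b) ≡ true → a ≡ true × b ≡ true
∧≡true⁻ {true} b≡true = refl , b≡true

permutation-injective : ∀ {n} (g : Permutation′ n) {x y} → g ⟨$⟩ʳ x ≡ g ⟨$⟩ʳ y → x ≡ y
permutation-injective g {x} {y} gx≡gy = begin
  x                   ≡⟨ sym (inverseˡ g) ⟩
  g ⟨$⟩ˡ (g ⟨$⟩ʳ x)  ≡⟨ cong (g ⟨$⟩ˡ_) gx≡gy ⟩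
  g ⟨$⟩ˡ (g ⟨$⟩ʳ y)  ≡⟨ inverseˡ g ⟩
  y                   ∎
  where open ≡-Reasoning

module _ {n} (Γ : Digraph n) where

  outNbrs : Fin n → List (Fin n)
  outNbrs u = filter (λ w → adj Γ u w ≟ᵇ true) (allFin n)

  commonOutNbrs : Fin n → Fin n → List (Fin n)
  commonOutNbrs u v = filter (λ w → (adj Γ u w ∧ adj Γ v w) ≟ᵇ true) (allFin n)

  ∈-outNbrs⁺ : ∀ {u w} → Arc Γ u w → w ∈ outNbrs u
  ∈-outNbrs⁺ {u} {w} = ∈-filter⁺ (λ w → adj Γ u w ≟ᵇ true) (∈-allFin w)

  ∈-commonOutNbrs⁻ : ∀ {u v w} → w ∈ commonOutNbrs u v → Arc Γ u w × Arc Γ v w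
  ∈-commonOutNbrs⁻ {u} {v} w∈ =
    ∧≡true⁻ (proj₂ (∈-filter⁻ (λ w → (adj Γ u w ∧ adj Γ v w) ≟ᵇ true) {xs = allFin n} w∈))

  commonOutNbrs-nonempty : ∀ {u v k} → commonOut Γ u v ≡ suc k → ∃ λ c → c ∈ commonOutNbrs u v
  commonOutNbrs-nonempty {u} {v} _ with commonOutNbrs u v
  ... | c ∷ _ = c , here refl

  commonOutNbrs-Unique : ∀ u v → Unique (commonOutNbrs u v)
  commonOutNbrs-Unique u v = filter⁺ _ (allFin⁺ n)

  arc⇒≢ : ∀ {u v} → Arc Γ u v → u ≢ v
  arc⇒≢ {u} u→u refl with trans (sym u→u) (irrefl Γ u)
  ... | ()

  arc⇒¬reverse : ∀ {u v} → Arc Γ u v → ¬ Arc Γ v u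
  arc⇒¬reverse {u} {v} u→v v→u with trans (sym v→u) (antisym Γ u v u→v)
  ... | ()

  aut-preserves-arc : ∀ g → IsAut Γ g → ∀ {u w} → Arc Γ u w → Arc Γ (g ⟨$⟩ʳ u) (g ⟨$⟩ʳ w)
  aut-preserves-arc g g∈Aut {u} {w} u→w = trans (g∈Aut u w) u→w

  2+commonOut≤outDeg : ∀ g → IsAut Γ g → ∀ {u v c} →
    Arc Γ u v → Arc Γ v c → g ⟨$⟩ʳ u ≡ u → g ⟨$⟩ʳ v ≡ c →
    suc (suc (commonOut Γ u v)) ≤ outDeg Γ u
  2+commonOut≤outDeg g g∈Aut {u} {v} {c} u→v v→c gu≡u gv≡c =
    subst (λ m → suc (suc m) ≤ outDeg Γ u) (length-map (g ⟨$⟩ʳ_) (commonOutNbrs u v))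
      (length-≤-Unique-⊆ _≟_ nbrs-Unique nbrs⊆outNbrs)
    where
    image : List (Fin n)
    image = map (g ⟨$⟩ʳ_) (commonOutNbrs u v)

    ∈-image⁻ : ∀ {y} → y ∈ image → Arc Γ u y × Arc Γ c y
    ∈-image⁻ y∈ with ∈-map⁻ (g ⟨$⟩ʳ_) y∈
    ... | w , w∈ , refl with ∈-commonOutNbrs⁻ w∈
    ... | u→w , v→w =
      subst (λ x → Arc Γ x (g ⟨$⟩ʳ w)) gu≡u (aut-preserves-arc g g∈Aut u→w) ,
      subst (λ x → Arc Γ x (g ⟨$⟩ʳ w)) gv≡c (aut-preserves-arc g g∈Aut v→w)

    u→c : Arc Γ u c
    u→c = subst₂ (Arc Γ) gu≡u gv≡c (aut-preserves-arc g g∈Aut u→v)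

    v∉image : ∀ {y} → y ∈ image → v ≢ y
    v∉image y∈ refl = arc⇒¬reverse v→c (proj₂ (∈-image⁻ y∈))

    c∉image : ∀ {y} → y ∈ image → c ≢ y
    c∉image y∈ refl = arc⇒≢ (proj₂ (∈-image⁻ y∈)) refl

    nbrs-Unique : Unique (v ∷ c ∷ image)
    nbrs-Unique =
      All.tabulate (λ { (here refl) → arc⇒≢ v→c ; (there y∈) → v∉image y∈ })
      ∷ All.tabulate c∉image
      ∷ map⁺ (permutation-injective g) (commonOutNbrs-Unique u v)

    nbrs⊆outNbrs : ∀ {x} → x ∈ v ∷ c ∷ image → x ∈ outNbrs u
    nbrs⊆outNbrs (here refl)         = ∈-outNbrs⁺ u→v
    nbrs⊆outNbrs (there (here refl)) = ∈-outNbrs⁺ u→c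
    nbrs⊆outNbrs (there (there y∈))  = ∈-outNbrs⁺ (proj₁ (∈-image⁻ y∈))

lemma4p1 : (n : ℕ) (Γ : Digraph n) (G : Subgroup Γ) (r : ℕ) →
    ArcTransitive G → HasValency Γ r → 2 ≤ r →
    ∀ u v → Arc Γ u v → ¬ (commonOut Γ u v ≡ r ∸ 1)
lemma4p1 n Γ G (suc (suc k)) arcTrans valency (s≤s (s≤s _)) u v u→v common≡1+k
  with commonOutNbrs-nonempty Γ common≡1+k
... | c , c∈ with ∈-commonOutNbrs⁻ Γ c∈
... | u→c , v→c with arcTrans u v u c u→v u→c
... | g , g∈G , gu≡u , gv≡c =
  n≮n (suc (suc k))
    (subst₂ (λ m d → suc (suc m) ≤ d) common≡1+k (valency u)
      (2+commonOut≤outDeg Γ g (isAut G g g∈G) u→v v→c gu≡u gv≡c))
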